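{- Let $n,x,k$ be integers with $n>x\ge k\ge 3$. Then $$P_{n+1}(x,k)=\sum_{j=\left\lfloor \frac{n-k-1}{n-x}\right\rfloor}^{k}P_{n-k}(x-k,j).$$
   Context: For integers $m\ge 0$ and $y,j\ge 0$, $B_m^{y,j}$ denotes the set of binary strings of length $m$ that contain exactly $y$ zeros and in which the longest block of consecutive zeros has length exactly $j$ (the all-ones string, including the empty string, lies in $B_m^{0,0}$). For a binary string $X$, let $X_l$ be the multiset of lengths of the maximal blocks of consecutive zeros of $X$. Two strings $X,Y\in B_m^{y,j}$ are equivalent if $X_l=Y_l$. $P_{m+1}(y,j)$ denotes the number of equivalence classes of $B_m^{y,j}$ under this relation (equivalently, the number of distinct multisets $X_l$ for $X\in B_m^{y,j}$; these correspond to partitions of $m+1$). -}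

module Defs where

open import Data.Bool using (Bool; true; false; _∧_)
open import Data.Nat using (ℕ; zero; suc; _+_; _∸_; _⊔_; _≡ᵇ_)
open import Data.Nat.DivMod using (_/_)
open import Data.Nat.ListAction using (sum)
open import Data.Nat.Properties using (≤-decTotalOrder)
open import Data.List using (List; []; _∷_; _++_; map; filter; foldr; length; upTo; deduplicate; concatMap)
open import Data.List.Properties using (≡-dec)
open import Data.List.Sort.InsertionSort.Base ≤-decTotalOrder using (sort)
import Data.Nat as ℕ
open import Relation.Nullary.Decidable using (does)
open import Relation.Nullary using (yes; no)
open import Relation.Unary using (Decidable)
open import Data.Bool using (T?)

-- Binary strings: 'false' is the digit 0, 'true' is the digit 1.

allStrings : ℕ → List (List Bool)
allStrings zero = [] ∷ []
allStrings (suc m) = concatMap (λ s → (false ∷ s) ∷ (true ∷ s) ∷ []) (allStrings m)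

zeros : List Bool → ℕ
zeros [] = 0
zeros (false ∷ s) = suc (zeros s)
zeros (true ∷ s) = zeros s

-- Lengths of the maximal blocks of consecutive zeros, scanning left to right;
-- the first argument is the length of the zero-run currently being read.
private
  flush : ℕ → List ℕ → List ℕ
  flush zero l = l
  flush (suc c) l = suc c ∷ l

blocksFrom : ℕ → List Bool → List ℕ
blocksFrom c [] = flush c []
blocksFrom c (false ∷ s) = blocksFrom (suc c) s
blocksFrom c (true ∷ s) = flush c (blocksFrom 0 s)

blocks : List Bool → List ℕ
blocks = blocksFrom 0

longest : List Bool → ℕ
longest s = foldr _⊔_ 0 (blocks s)

-- X_l: the multiset of block lengths, represented canonically as a sorted list.
multisetL : List Bool → List ℕ
multisetL s = sort (blocks s)

inB : ℕ → ℕ → List Bool → Bool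
inB y j s = (zeros s ≡ᵇ y) ∧ (longest s ≡ᵇ j)

B : ℕ → ℕ → ℕ → List (List Bool)
B m y j = filter (λ s → T? (inB y j s)) (allStrings m)

-- The distinct multisets X_l for X ∈ B_m^{y,j}, i.e. the equivalence classes.
classes : ℕ → ℕ → ℕ → List (List ℕ)
classes m y j = deduplicate (≡-dec ℕ._≟_) (map multisetL (B m y j))

-- Paper indexing: P_{m+1}(y,j) = number of equivalence classes of B_m^{y,j}.
-- (P_0 is not used by the paper; set to 0.)
P : ℕ → ℕ → ℕ → ℕ
P zero y j = 0
P (suc m) y j = length (classes m y j)

-- floor(a / b) for b ≥ 1 (value 0 when b = 0, never used).
floorDiv : ℕ → ℕ → ℕ
floorDiv a zero = 0
floorDiv a (suc b) = a / suc b

-- Σ_{j = lo}^{hi} f j  (empty sum = 0 when lo > hi).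
sumFromTo : ℕ → ℕ → (ℕ → ℕ) → ℕ
sumFromTo lo hi f = sum (map (λ i → f (lo + i)) (upTo (suc hi ∸ lo)))

module Submission where

-- A class of B_m^{y,j} is determined by its multiset of zero-block lengths,
-- and these multisets are exactly the "profiles": ascending lists z of
-- positive parts with sum z = y, maximum z = j and |z| + y ≤ m + 1 (the
-- |z| blocks need |z| - 1 separating ones).  Strings give profiles by
-- reading off their blocks; a profile is realised by writing its blocks
-- separated by single ones and padding with ones.
--
-- Write x = k + e and n = k + e + d + 1.  Removing the last (= largest)
-- part k turns a profile for B_n^{x,k} into a profile for B_{e+d}^{e,j}
-- with j ≤ k, and appending k is the inverse; every such j is at least
-- ⌊(e+d)/(d+1)⌋ because the e zeros lie in at most d + 1 blocks.  Both
-- sides of the theorem therefore count the same duplicate-free list of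
-- profiles.  (The argument only needs k ≥ 1.)

open import Defs
open import Data.Bool using (Bool; true; false; T?)
open import Data.Bool.Properties using (T-∧)
open import Data.Empty using (⊥-elim)
open import Data.List
  using (List; []; _∷_; _++_; _∷ʳ_; map; foldr; length; replicate; upTo; initLast; _∷ʳ′_)
open import Data.List.Properties
  using (≡-dec; length-++; length-map; length-replicate; map-∘; ∷ʳ-injectiveˡ;
         foldr-preservesᵇ; foldr-forcesᵇ)
open import Data.List.Membership.Propositional using (_∈_)
open import Data.List.Membership.Propositional.Properties
  using (∈-map⁺; ∈-map⁻; ∈-concat⁺′; ∈-concat⁻′; ∈-filter⁺; ∈-filter⁻;
         ∈-++⁺ˡ; ∈-++⁺ʳ; ∈-++⁻; ∈-upTo⁺; ∈-upTo⁻)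
open import Data.List.Relation.Binary.Disjoint.Propositional using (Disjoint)
open import Data.List.Relation.Binary.Permutation.Propositional using (_↭_; ↭-sym; ↭⇒↭ₛ)
open import Data.List.Relation.Binary.Permutation.Propositional.Properties
  using (∷↭∷ʳ; All-resp-↭; ↭-length)
open import Data.List.Relation.Binary.Permutation.Setoid.Properties using (foldr-commMonoid)
open import Data.List.Relation.Binary.Subset.Propositional using (_⊆_)
open import Data.List.Relation.Unary.All using (All; []; _∷_)
import Data.List.Relation.Unary.All as All
import Data.List.Relation.Unary.All.Properties as AllProps
open import Data.List.Relation.Unary.AllPairs using (AllPairs; []; _∷_)
import Data.List.Relation.Unary.AllPairs.Properties as AllPairs
import Data.List.Relation.Unary.Any.Properties as Any
open import Data.List.Relation.Unary.Any using (here; there)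
open import Data.List.Relation.Unary.Linked.Properties using (Linked⇒AllPairs)
open import Data.List.Relation.Unary.Unique.Propositional using (Unique)
import Data.List.Relation.Unary.Unique.Propositional.Properties as Unique
open import Data.Nat
open import Data.Nat.Properties
open import Data.List.Relation.Unary.Unique.DecPropositional.Properties (≡-dec _≟_)
  using (deduplicate-!)
open import Data.List.Sort.InsertionSort.Base ≤-decTotalOrder using (sort; insert)
import Data.List.Sort.InsertionSort.Properties ≤-decTotalOrder as Sort
open import Data.Nat.DivMod using (_/_; m<n*o⇒m/o<n)
open import Data.Nat.ListAction using (sum)
open import Data.Nat.ListAction.Properties using (sum-↭)
open import Data.Nat.Tactic.RingSolver using (solve-∀)
open import Data.Product using (_×_; _,_; proj₁; proj₂; ∃-syntax)
open import Data.Sum using (inj₁; inj₂)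
open import Algebra.Bundles using (CommutativeMonoid)
open import Function.Bundles using (Equivalence; _⇔_; mk⇔)
open import Relation.Nullary.Decidable using (dec-true)
open import Relation.Binary.PropositionalEquality


delete : {A : Set} {a : A} (xs : List A) → a ∈ xs → List A
delete (_ ∷ xs) (here _)  = xs
delete (x ∷ xs) (there p) = x ∷ delete xs p

length-delete : {A : Set} {a : A} (xs : List A) (p : a ∈ xs) →
                suc (length (delete xs p)) ≡ length xs
length-delete (_ ∷ xs) (here _)  = refl
length-delete (x ∷ xs) (there p) = cong suc (length-delete xs p)

∈-delete : {A : Set} {a b : A} (xs : List A) (p : a ∈ xs) → b ∈ xs → b ≢ a → b ∈ delete xs p
∈-delete (_ ∷ xs) (here refl) (here refl) b≢a = ⊥-elim (b≢a refl)
∈-delete (_ ∷ xs) (here refl) (there q)   b≢a = q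
∈-delete (_ ∷ xs) (there p)   (here refl) b≢a = here refl
∈-delete (_ ∷ xs) (there p)   (there q)   b≢a = there (∈-delete xs p q b≢a)

unique-⊆⇒length-≤ : {A : Set} {xs ys : List A} → Unique xs → xs ⊆ ys → length xs ≤ length ys
unique-⊆⇒length-≤ {xs = []}     _           _   = z≤n
unique-⊆⇒length-≤ {xs = a ∷ xs} {ys} (a∉xs ∷ u) xs⊆ys =
  subst (suc (length xs) ≤_) (length-delete ys a∈ys) (s≤s (unique-⊆⇒length-≤ u xs⊆rest))
  where
  a∈ys : a ∈ ys
  a∈ys = xs⊆ys (here refl)
  xs⊆rest : xs ⊆ delete ys a∈ys
  xs⊆rest b∈xs = ∈-delete ys a∈ys (xs⊆ys (there b∈xs)) (λ b≡a → All.lookup a∉xs b∈xs (sym b≡a))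

unique-length-≡ : {A : Set} {xs ys : List A} → Unique xs → Unique ys →
                  xs ⊆ ys → ys ⊆ xs → length xs ≡ length ys
unique-length-≡ uxs uys xs⊆ys ys⊆xs =
  ≤-antisym (unique-⊆⇒length-≤ uxs xs⊆ys) (unique-⊆⇒length-≤ uys ys⊆xs)


maximum : List ℕ → ℕ
maximum = foldr _⊔_ 0

-- ⊔ with unit 0 is a commutative monoid, so the maximum ignores order.
maximum-↭ : {xs ys : List ℕ} → xs ↭ ys → maximum xs ≡ maximum ys
maximum-↭ p = foldr-commMonoid ⊔-0.setoid ⊔-0.isCommutativeMonoid (↭⇒↭ₛ p)
  where module ⊔-0 = CommutativeMonoid ⊔-0-commutativeMonoid

maximum-∷ʳ : ∀ xs a → maximum (xs ∷ʳ a) ≡ a ⊔ maximum xs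
maximum-∷ʳ xs a = sym (maximum-↭ (∷↭∷ʳ a xs))

sum-∷ʳ : ∀ xs a → sum (xs ∷ʳ a) ≡ a + sum xs
sum-∷ʳ xs a = sym (sum-↭ (∷↭∷ʳ a xs))

maximum-≤ : ∀ {a xs} → All (_≤ a) xs → maximum xs ≤ a
maximum-≤ = foldr-preservesᵇ ⊔-lub z≤n

≤-maximum : ∀ xs → All (_≤ maximum xs) xs
≤-maximum xs = foldr-forcesᵇ (λ m n m⊔n≤o → m⊔n≤o⇒m≤o m n m⊔n≤o , m⊔n≤o⇒n≤o m n m⊔n≤o) 0 xs ≤-refl

sum-≤ : ∀ {a xs} → All (_≤ a) xs → sum xs ≤ length xs * a
sum-≤ []       = z≤n
sum-≤ (p ∷ ps) = +-mono-≤ p (sum-≤ ps)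

allPairs-∷ʳ⁻ : {A : Set} {R : A → A → Set} (xs : List A) {a : A} → AllPairs R (xs ∷ʳ a) → AllPairs R xs × All (λ x → R x a) xs
allPairs-∷ʳ⁻ []       _        = [] , []
allPairs-∷ʳ⁻ (x ∷ xs) (h ∷ hs) =
  let (ps , qs) = allPairs-∷ʳ⁻ xs hs
  in  AllProps.++⁻ˡ xs h ∷ ps , proj₂ (AllProps.∷ʳ⁻ h) ∷ qs

maximum-ascending : ∀ xs a → AllPairs _≤_ (xs ∷ʳ a) → maximum (xs ∷ʳ a) ≡ a
maximum-ascending xs a asc =
  trans (maximum-∷ʳ xs a) (m≥n⇒m⊔n≡m (maximum-≤ (proj₂ (allPairs-∷ʳ⁻ xs asc))))


-- The lists that arise as X_l for X ∈ B_m^{y,j}, in sorted representation.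
record IsProfile (m y j : ℕ) (z : List ℕ) : Set where
  constructor profile
  field
    ascending : AllPairs _≤_ z
    positive  : All (0 <_) z
    total     : sum z ≡ y
    largest   : maximum z ≡ j
    fits      : length z + y ≤ suc m

open IsProfile

Realisable : ℕ → ℕ → ℕ → List ℕ → Set
Realisable m y j z = ∃[ s ] (length s ≡ m × zeros s ≡ y × longest s ≡ j × multisetL s ≡ z)


allStrings-length : ∀ m {s} → s ∈ allStrings m → length s ≡ m
allStrings-length zero    (here refl) = refl
allStrings-length (suc m) s∈
  with _ , s∈pair , pair∈ ← ∈-concat⁻′ (map (λ s → (false ∷ s) ∷ (true ∷ s) ∷ []) (allStrings m)) s∈
  with t , t∈ , refl ← ∈-map⁻ _ pair∈
  with s∈pair
... | here refl         = cong suc (allStrings-length m t∈)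
... | there (here refl) = cong suc (allStrings-length m t∈)

allStrings-complete : ∀ s → s ∈ allStrings (length s)
allStrings-complete []      = here refl
allStrings-complete (b ∷ s) =
  ∈-concat⁺′ (choice b) (∈-map⁺ (λ s → (false ∷ s) ∷ (true ∷ s) ∷ []) (allStrings-complete s))
  where
  choice : ∀ b → (b ∷ s) ∈ ((false ∷ s) ∷ (true ∷ s) ∷ [])
  choice false = here refl
  choice true  = there (here refl)

∈-classes⇒realisable : ∀ m y j {z} → z ∈ classes m y j → Realisable m y j z
∈-classes⇒realisable m y j z∈
  with s , s∈B , refl ← ∈-map⁻ multisetL (Any.deduplicate⁻ (≡-dec _≟_) z∈)
  with s∈ , s-in-B ← ∈-filter⁻ (λ s → T? (inB y j s)) {xs = allStrings m} s∈B
  with zeros≡ , longest≡ ← Equivalence.to T-∧ s-in-B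
  = s , allStrings-length m s∈ , ≡ᵇ⇒≡ _ _ zeros≡ , ≡ᵇ⇒≡ _ _ longest≡ , refl

realisable⇒∈-classes : ∀ {m y j z} → Realisable m y j z → z ∈ classes m y j
realisable⇒∈-classes (s , refl , refl , refl , refl) =
  Any.deduplicate⁺ (≡-dec _≟_) (λ { refl q → q })
    (∈-map⁺ multisetL (∈-filter⁺ (λ t → T? (inB (zeros s) (longest s) t)) (allStrings-complete s)
       (Equivalence.from T-∧ (≡⇒≡ᵇ (zeros s) _ refl , ≡⇒≡ᵇ (longest s) _ refl))))


blocksFrom-positive : ∀ c s → All (0 <_) (blocksFrom c s)
blocksFrom-positive zero    []          = []
blocksFrom-positive (suc c) []          = s≤s z≤n ∷ []
blocksFrom-positive c       (false ∷ s) = blocksFrom-positive (suc c) s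
blocksFrom-positive zero    (true ∷ s)  = blocksFrom-positive 0 s
blocksFrom-positive (suc c) (true ∷ s)  = s≤s z≤n ∷ blocksFrom-positive 0 s

blocksFrom-sum : ∀ c s → sum (blocksFrom c s) ≡ c + zeros s
blocksFrom-sum zero    []          = refl
blocksFrom-sum (suc c) []          = refl
blocksFrom-sum c       (false ∷ s) = trans (blocksFrom-sum (suc c) s) (sym (+-suc c (zeros s)))
blocksFrom-sum zero    (true ∷ s)  = blocksFrom-sum 0 s
blocksFrom-sum (suc c) (true ∷ s)  = cong (suc c +_) (blocksFrom-sum 0 s)

-- Consecutive blocks are separated by ones, so blocks + zeros ≤ length + 1.
blocksFrom-length : ∀ c s → length (blocksFrom c s) + zeros s ≤ suc (length s)
blocksFrom-length zero    []          = z≤n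
blocksFrom-length (suc c) []          = s≤s z≤n
blocksFrom-length c       (false ∷ s) =
  subst (_≤ suc (suc (length s))) (sym (+-suc (length (blocksFrom (suc c) s)) (zeros s)))
        (s≤s (blocksFrom-length (suc c) s))
blocksFrom-length zero    (true ∷ s)  = m≤n⇒m≤1+n (blocksFrom-length 0 s)
blocksFrom-length (suc c) (true ∷ s)  = s≤s (blocksFrom-length 0 s)

-- Sorting keeps the sum, maximum and number of the blocks: X_l is a profile.
profile-of-string : ∀ s → IsProfile (length s) (zeros s) (longest s) (multisetL s)
profile-of-string s = profile
  (Linked⇒AllPairs ≤-trans (Sort.sort-↗ (blocks s)))
  (All-resp-↭ (↭-sym sort↭) (blocksFrom-positive 0 s))
  (trans (sum-↭ sort↭) (blocksFrom-sum 0 s))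
  (maximum-↭ sort↭)
  (subst (λ l → l + zeros s ≤ suc (length s)) (sym (↭-length sort↭)) (blocksFrom-length 0 s))
  where
  sort↭ : sort (blocks s) ↭ blocks s
  sort↭ = Sort.sort-↭ (blocks s)


runs : List ℕ → ℕ → List Bool
runs []      p = replicate p true
runs (a ∷ r) p = true ∷ replicate a false ++ runs r p

code : List ℕ → ℕ → List Bool
code []      p = replicate p true
code (a ∷ r) p = replicate a false ++ runs r p

blocksFrom-zeroRun : ∀ c a s → blocksFrom c (replicate a false ++ s) ≡ blocksFrom (c + a) s
blocksFrom-zeroRun c zero    s = cong (λ c → blocksFrom c s) (sym (+-identityʳ c))
blocksFrom-zeroRun c (suc a) s = trans (blocksFrom-zeroRun (suc c) a s) (cong (λ c → blocksFrom c s) (sym (+-suc c a)))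

blocks-ones : ∀ p → blocks (replicate p true) ≡ []
blocks-ones zero    = refl
blocks-ones (suc p) = blocks-ones p

blocksFrom-runs : ∀ a r p → All (0 <_) r → blocksFrom (suc a) (runs r p) ≡ suc a ∷ r
blocksFrom-runs a []          zero    _        = refl
blocksFrom-runs a []          (suc p) _        = cong (suc a ∷_) (blocks-ones p)
blocksFrom-runs a (suc b ∷ r) p       (_ ∷ ps) =
  cong (suc a ∷_) (trans (blocksFrom-zeroRun 0 (suc b) (runs r p)) (blocksFrom-runs b r p ps))

blocks-code : ∀ z p → All (0 <_) z → blocks (code z p) ≡ z
blocks-code []          p _        = blocks-ones p
blocks-code (suc a ∷ r) p (_ ∷ ps) = trans (blocksFrom-zeroRun 0 (suc a) (runs r p)) (blocksFrom-runs a r p ps)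

length-zeroRun-++ : ∀ a s → length (replicate a false ++ s) ≡ a + length s
length-zeroRun-++ a s = trans (length-++ (replicate a false)) (cong (_+ length s) (length-replicate a))

length-runs : ∀ r p → length (runs r p) ≡ sum r + length r + p
length-runs []      p = length-replicate p
length-runs (a ∷ r) p = begin
  suc (length (replicate a false ++ runs r p)) ≡⟨ cong suc (length-zeroRun-++ a (runs r p)) ⟩
  suc (a + length (runs r p))                  ≡⟨ cong (λ l → suc (a + l)) (length-runs r p) ⟩
  suc (a + (sum r + length r + p))             ≡⟨ regroup a (sum r) (length r) p ⟩
  a + sum r + suc (length r) + p               ∎
  where
  open ≡-Reasoning
  regroup : ∀ a s l p → suc (a + (s + l + p)) ≡ a + s + suc l + p
  regroup = solve-∀

length-code : ∀ a r p → length (code (a ∷ r) p) ≡ a + (sum r + length r) + p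
length-code a r p = begin
  length (replicate a false ++ runs r p) ≡⟨ length-zeroRun-++ a (runs r p) ⟩
  a + length (runs r p)                  ≡⟨ cong (a +_) (length-runs r p) ⟩
  a + (sum r + length r + p)             ≡⟨ +-assoc a (sum r + length r) p ⟨
  a + (sum r + length r) + p             ∎
  where open ≡-Reasoning

sort-ascending : ∀ {z} → AllPairs _≤_ z → sort z ≡ z
sort-ascending {[]}    _        = refl
sort-ascending {a ∷ r} (h ∷ hs) rewrite sort-ascending hs = insert-least r h
  where
  insert-least : ∀ r → All (a ≤_) r → insert a r ≡ a ∷ r
  insert-least []      _        = refl
  insert-least (b ∷ r) (a≤b ∷ _) rewrite dec-true (a ≤? b) a≤b = refl

realise : ∀ {m y j z} s → length s ≡ m → blocks s ≡ z → IsProfile m y j z → Realisable m y j z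
realise s len blocks≡ p =
  s , len ,
  trans (sym (blocksFrom-sum 0 s)) (trans (cong sum blocks≡) (total p)) ,
  trans (cong maximum blocks≡) (largest p) ,
  trans (cong sort blocks≡) (sort-ascending (ascending p))

-- Realise z by its code padded with ones; `fits` says the unpadded code
-- (of length K = sum z + length z - 1) is no longer than m.
profile⇒realisable : ∀ {m y j z} → IsProfile m y j z → Realisable m y j z
profile⇒realisable {m} {z = []}    p = realise (replicate m true) (length-replicate m) (blocks-ones m) p
profile⇒realisable {m} {z = a ∷ r} p =
  realise (code (a ∷ r) (m ∸ K)) length≡m (blocks-code (a ∷ r) (m ∸ K) (positive p)) p
  where
  K : ℕ
  K = a + (sum r + length r)
  K≤m : K ≤ m
  K≤m = subst (_≤ m) (trans (cong (length r +_) (sym (total p))) (swap (length r) a (sum r)))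
              (s≤s⁻¹ (fits p))
    where
    swap : ∀ l a s → l + (a + s) ≡ a + (s + l)
    swap = solve-∀
  length≡m : length (code (a ∷ r) (m ∸ K)) ≡ m
  length≡m = trans (length-code a r (m ∸ K)) (m+[n∸m]≡n K≤m)


∈-classes⇒profile : ∀ m y j {z} → z ∈ classes m y j → IsProfile m y j z
∈-classes⇒profile m y j z∈ with s , refl , refl , refl , refl ← ∈-classes⇒realisable m y j z∈ =
  profile-of-string s

profile⇒∈-classes : ∀ {m y j z} → IsProfile m y j z → z ∈ classes m y j
profile⇒∈-classes p = realisable⇒∈-classes (profile⇒realisable p)


classesOver : ℕ → ℕ → List ℕ → List (List ℕ)
classesOver m y []       = []
classesOver m y (j ∷ js) = classes m y j ++ classesOver m y js

length-classesOver : ∀ m y js → length (classesOver m y js) ≡ sum (map (P (suc m) y) js)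
length-classesOver m y []       = refl
length-classesOver m y (j ∷ js) =
  trans (length-++ (classes m y j)) (cong (P (suc m) y j +_) (length-classesOver m y js))

∈-classesOver⁻ : ∀ m y js {z} → z ∈ classesOver m y js → ∃[ j ] (j ∈ js × IsProfile m y j z)
∈-classesOver⁻ m y (j ∷ js) z∈ with ∈-++⁻ (classes m y j) z∈
... | inj₁ z∈j  = j , here refl , ∈-classes⇒profile m y j z∈j
... | inj₂ z∈js = let (j′ , j′∈ , p) = ∈-classesOver⁻ m y js z∈js in j′ , there j′∈ , p

∈-classesOver⁺ : ∀ {m y j z js} → j ∈ js → IsProfile m y j z → z ∈ classesOver m y js
∈-classesOver⁺ {js = _ ∷ _}          (here refl) p = ∈-++⁺ˡ (profile⇒∈-classes p)
∈-classesOver⁺ {m} {y} {js = j ∷ js} (there j∈)  p = ∈-++⁺ʳ (classes m y j) (∈-classesOver⁺ j∈ p)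

-- Classes with different maxima are different, so no class is listed twice.
classesOver-unique : ∀ {m y js} → Unique js → Unique (classesOver m y js)
classesOver-unique {js = []}     []           = []
classesOver-unique {m} {y} {j ∷ js} (j∉js ∷ u) =
  Unique.++⁺ (deduplicate-! _) (classesOver-unique u) disjoint
  where
  disjoint : Disjoint (classes m y j) (classesOver m y js)
  disjoint (z∈j , z∈js) with j′ , j′∈js , p ← ∈-classesOver⁻ m y js z∈js =
    All.lookup j∉js j′∈js (trans (sym (largest (∈-classes⇒profile m y j z∈j))) (largest p))

range : ℕ → ℕ → List ℕ
range lo hi = map (lo +_) (upTo (suc hi ∸ lo))

∈-range⁻ : ∀ {lo hi j} → j ∈ range lo hi → lo ≤ j × j ≤ hi
∈-range⁻ {lo} {hi} j∈ with i , i∈ , refl ← ∈-map⁻ (lo +_) j∈ = m≤m+n lo i , s≤s⁻¹ lo+i<1+hi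
  where
  i<c : i < suc hi ∸ lo
  i<c = ∈-upTo⁻ i∈
  lo≤1+hi : lo ≤ suc hi
  lo≤1+hi = <⇒≤ (m∸n≢0⇒n<m (λ c≡0 → n≮0 (subst (i <_) c≡0 i<c)))
  lo+i<1+hi : lo + i < suc hi
  lo+i<1+hi = subst (lo + i <_) (m+[n∸m]≡n lo≤1+hi) (+-monoʳ-< lo i<c)

∈-range⁺ : ∀ {lo hi j} → lo ≤ j → j ≤ hi → j ∈ range lo hi
∈-range⁺ {lo} {hi} lo≤j j≤hi with i , refl ← m≤n⇒∃[o]m+o≡n lo≤j =
  ∈-map⁺ (lo +_) (∈-upTo⁺ (m+n≤o⇒m≤o∸n (suc i) (s≤s (subst (_≤ hi) (+-comm lo i) j≤hi))))

range-unique : ∀ lo hi → Unique (range lo hi)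
range-unique lo hi = Unique.map⁺ (+-cancelˡ-≡ lo _ _) (Unique.upTo⁺ (suc hi ∸ lo))

sumFromTo-range : ∀ lo hi f → sumFromTo lo hi f ≡ sum (map f (range lo hi))
sumFromTo-range lo hi f = cong sum (map-∘ (upTo (suc hi ∸ lo)))


-- One more part and k more zeros need exactly k + 1 more places.
fits-∷ʳ : ∀ w k e M → (length (w ∷ʳ k) + (k + e) ≤ suc (suc (k + M))) ⇔ (length w + e ≤ suc M)
fits-∷ʳ w k e M = mk⇔
  (λ fits′ → s≤s⁻¹ (+-cancelˡ-≤ k _ _ (subst₂ _≤_ lhs rhs fits′)))
  (λ fits → subst₂ _≤_ (sym lhs) (sym rhs) (+-monoʳ-≤ k (s≤s fits)))
  where
  shift : ∀ l k e → suc l + (k + e) ≡ k + suc (l + e)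
  shift = solve-∀
  lhs : length (w ∷ʳ k) + (k + e) ≡ k + suc (length w + e)
  lhs = trans (cong (_+ (k + e)) (trans (length-++ w) (+-comm (length w) 1))) (shift (length w) k e)
  rhs : suc (suc (k + M)) ≡ k + suc (suc M)
  rhs = sym (trans (+-suc k (suc M)) (cong suc (+-suc k M)))

profile-∷ʳ⁻ : ∀ {M e k} w → IsProfile (suc (k + M)) (k + e) k (w ∷ʳ k) → IsProfile M e (maximum w) w
profile-∷ʳ⁻ {M} {e} {k} w p = profile
  (proj₁ (allPairs-∷ʳ⁻ w (ascending p)))
  (AllProps.++⁻ˡ w (positive p))
  (+-cancelˡ-≡ k _ _ (trans (sym (sum-∷ʳ w k)) (total p)))
  refl
  (Equivalence.to (fits-∷ʳ w k e M) (fits p))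

profile-∷ʳ⁺ : ∀ {M e j k w} → 0 < k → j ≤ k → IsProfile M e j w → IsProfile (suc (k + M)) (k + e) k (w ∷ʳ k)
profile-∷ʳ⁺ {M} {e} {k = k} {w} 0<k j≤k p = profile
  (AllPairs.++⁺ (ascending p) ([] ∷ []) (All.map (_∷ []) w≤k))
  (AllProps.∷ʳ⁺ (positive p) 0<k)
  (trans (sum-∷ʳ w k) (cong (k +_) (total p)))
  (trans (maximum-∷ʳ w k) (m≥n⇒m⊔n≡m max≤k))
  (Equivalence.from (fits-∷ʳ w k e M) (fits p))
  where
  max≤k : maximum w ≤ k
  max≤k = subst (_≤ k) (sym (largest p)) j≤k
  w≤k : All (_≤ k) w
  w≤k = All.map (λ x≤max → ≤-trans x≤max max≤k) (≤-maximum w)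

profile-split : ∀ {M e k z} → 0 < k → IsProfile (suc (k + M)) (k + e) k z →
                ∃[ w ] (z ≡ w ∷ʳ k × maximum w ≤ k × IsProfile M e (maximum w) w)
profile-split {z = z} 0<k p with initLast z
... | []       = ⊥-elim (<⇒≢ 0<k (largest p))
... | w ∷ʳ′ a with refl ← trans (sym (maximum-ascending w a (ascending p))) (largest p) =
  w , refl , maximum-≤ (proj₂ (allPairs-∷ʳ⁻ w (ascending p))) , profile-∷ʳ⁻ w p

-- ⌈e / (d+1)⌉ = ⌊(e+d)/(d+1)⌋ is a lower bound for j whenever e ≤ j(d+1).
ceiling-bound : ∀ e d j → e ≤ j * suc d → (e + d) / suc d ≤ j
ceiling-bound e d j e≤ = s≤s⁻¹ (m<n*o⇒m/o<n {e + d} {suc j} {suc d} e+d<)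
  where
  e+d< : e + d < suc j * suc d
  e+d< = subst (_≤ suc d + j * suc d) (cong suc (+-comm d e)) (+-monoʳ-≤ (suc d) e≤)

-- A profile with sum e has at most d + 1 parts, hence a part ≥ ⌈e/(d+1)⌉.
profile-lowerBound : ∀ {e d j w} → IsProfile (e + d) e j w → (e + d) / suc d ≤ j
profile-lowerBound {e} {d} {j} {w} p = ceiling-bound e d j (begin
  e                   ≡⟨ total p ⟨
  sum w               ≤⟨ sum-≤ w≤j ⟩
  length w * j        ≤⟨ *-monoˡ-≤ j parts≤ ⟩
  suc d * j           ≡⟨ *-comm (suc d) j ⟩
  j * suc d           ∎)
  where
  open ≤-Reasoning
  w≤j : All (_≤ j) w
  w≤j = subst (λ m → All (_≤ m) w) (largest p) (≤-maximum w)
  parts≤ : length w ≤ suc d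
  parts≤ = +-cancelʳ-≤ e (length w) (suc d) (subst (length w + e ≤_) (cong suc (+-comm e d)) (fits p))


-- Appending k is a bijection from the profiles of B_{e+d}^{e,j}, lo ≤ j ≤ k,
-- onto the profiles of B_{k+e+d+1}^{k+e,k}.
classes-recurrence : ∀ k e d → 0 < k →
  length (classes (suc (k + (e + d))) (k + e) k) ≡ sum (map (P (suc (e + d)) e) (range ((e + d) / suc d) k))
classes-recurrence k e d 0<k = begin
  length (classes (suc (k + M)) (k + e) k)   ≡⟨ unique-length-≡ (deduplicate-! _) appended-unique remove-k append-k ⟩
  length (map (_∷ʳ k) (classesOver M e js))  ≡⟨ length-map (_∷ʳ k) (classesOver M e js) ⟩
  length (classesOver M e js)                ≡⟨ length-classesOver M e js ⟩
  sum (map (P (suc M) e) js)                 ∎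
  where
  open ≡-Reasoning
  M = e + d
  js = range (M / suc d) k
  appended-unique : Unique (map (_∷ʳ k) (classesOver M e js))
  appended-unique = Unique.map⁺ (λ {v} {w} → ∷ʳ-injectiveˡ v w) (classesOver-unique (range-unique (M / suc d) k))
  remove-k : classes (suc (k + M)) (k + e) k ⊆ map (_∷ʳ k) (classesOver M e js)
  remove-k z∈ with w , refl , max≤k , p ← profile-split 0<k (∈-classes⇒profile _ _ _ z∈) =
    ∈-map⁺ (_∷ʳ k) (∈-classesOver⁺ (∈-range⁺ (profile-lowerBound p) max≤k) p)
  append-k : map (_∷ʳ k) (classesOver M e js) ⊆ classes (suc (k + M)) (k + e) k
  append-k z∈ with w , w∈ , refl ← ∈-map⁻ (_∷ʳ k) z∈ with j , j∈ , p ← ∈-classesOver⁻ M e js w∈ =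
    profile⇒∈-classes (profile-∷ʳ⁺ 0<k (proj₂ (∈-range⁻ j∈)) p)

suc-+∸ : ∀ k M → suc (k + M) ∸ k ≡ suc M
suc-+∸ k M = trans (cong (_∸ k) (sym (+-suc k M))) (m+n∸m≡n k (suc M))

-- With x = k + e and n = k + e + d + 1 the theorem is the recurrence above.
theorem4p4 : (n x k : ℕ) → x < n → k ≤ x → 3 ≤ k →
    P (suc n) x k ≡ sumFromTo (floorDiv (n ∸ k ∸ 1) (n ∸ x)) k (λ j → P (n ∸ k) (x ∸ k) j)
theorem4p4 n x k x<n k≤x 3≤k
  with e , refl ← m≤n⇒∃[o]m+o≡n k≤x
  with d , refl ← m≤n⇒∃[o]m+o≡n x<n
  rewrite suc-+∸ (k + e) d | +-assoc k e d | suc-+∸ k (e + d) | m+n∸m≡n k e = begin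
    length (classes (suc (k + (e + d))) (k + e) k)            ≡⟨ classes-recurrence k e d (≤-trans (s≤s z≤n) 3≤k) ⟩
    sum (map (P (suc (e + d)) e) (range ((e + d) / suc d) k)) ≡⟨ sumFromTo-range ((e + d) / suc d) k (P (suc (e + d)) e) ⟨
    sumFromTo ((e + d) / suc d) k (P (suc (e + d)) e)         ∎
  where open ≡-Reasoning
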